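{- Let $G$ be a finite abelian group of type $(m_1,\ldots,m_{\operatorname{rk}(G)})$ with $|G|$ even. Then there is a subset $S\subseteq G$ with $$ |S|=\begin{cases}\operatorname{rk}(G) & \text{if } m_1=2,\\ \operatorname{rk}(G)+1 & \text{if } m_1>2,\end{cases}$$ such that $\Gamma_G(S)$ is Hamiltonian.
   Context: For a subset $S$ of a finite abelian group $G$, the addition Cayley graph $\Gamma_G(S)$ has vertex set $G$ and edge set $\{(g',g'')\in G\times G : g'+g''\in S\}$. $\Gamma_G(S)$ is Hamiltonian if there is a listing $(g_1,\ldots,g_n)$ of all $n=|G|$ elements of $G$ with $g_i+g_{i+1}\in S$ for all $i$ (indices mod $n$); when $|G|=2$ and $S$ contains the non-zero element, $\Gamma_G(S)$ counts as Hamiltonian. $\operatorname{rk}(G)$ is the rank of $G$. "$G$ is of type $(m_1,\ldots,m_r)$" means $G\cong \mathbb Z/m_1\mathbb Z\oplus\cdots\oplus\mathbb Z/m_r\mathbb Z$ with $1<m_1\mid m_2\mid\cdots\mid m_r$, $r=\operatorname{rk}(G)$. -}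

module Defs where

open import Data.Nat using (ℕ; zero; suc; _%_)
open import Data.Nat.DivMod using (m%n<n)
open import Data.Fin using (Fin; toℕ; fromℕ<)
open import Data.Product using (_×_; _,_; ∃)
open import Data.Unit using (⊤; tt)
open import Data.List using (List; []; _∷_; _++_; [_]; zipWith)
open import Data.List.Membership.Propositional using (_∈_)
open import Data.List.Relation.Unary.All using (All)
open import Data.List.Relation.Unary.Unique.Propositional using (Unique)

_+ₘ_ : ∀ {m} → Fin m → Fin m → Fin m
_+ₘ_ {suc k} a b = fromℕ< (m%n<n (toℕ a + toℕ b) (suc k))
  where open Data.Nat using (_+_)

Grp : List ℕ → Set
Grp []       = ⊤
Grp (m ∷ ms) = Fin m × Grp ms

_⊕_ : ∀ {ms} → Grp ms → Grp ms → Grp ms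
_⊕_ {[]}     tt       tt       = tt
_⊕_ {m ∷ ms} (a , x)  (b , y)  = (a +ₘ b) , (x ⊕ y)

cyclicSums : ∀ {ms} → List (Grp ms) → List (Grp ms)
cyclicSums []       = []
cyclicSums (x ∷ xs) = zipWith _⊕_ (x ∷ xs) (xs ++ [ x ])

-- The addition Cayley graph Γ_G(S) is Hamiltonian: there is a listing of all
-- elements of G (each exactly once) with g_i + g_{i+1} ∈ S for all i (mod n).
-- (For |G| = 2 this is exactly the convention "S contains the non-zero element".)
Hamiltonian : ∀ {ms} → List (Grp ms) → Set
Hamiltonian {ms} S =
  ∃ λ (L : List (Grp ms)) →
    Unique L × (∀ (g : Grp ms) → g ∈ L) × All (λ s → s ∈ S) (cyclicSums L)

{-# OPTIONS --safe #-}
-- A Hamiltonian cycle of Γ_A(S) is called coloured if its vertices carry colours in ℤ/2 that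
-- alternate along it. For even m > 2, the cycle 0, −1, 2, −3, …, m − 1 of Γ_{ℤ/m}({1, −1})
-- is coloured by parity, its consecutive sums alternating between −1 and 1; for m = 2 the
-- set {1} suffices. A coloured cycle a₀, …, a_{N−1} of Γ_A(S) lifts, for every m ≥ 2, to one
-- of Γ_{ℤ/m × A}(S′) with |S′| = |S| + 1: traverse it m times, visiting in lap t the vertex
-- (t, a) for a of colour 0 and (−t, a) for a of colour 1. Sums inside a lap are (0, aᵢ + aᵢ₊₁),
-- and every passage from lap t to lap t + 1 (mod m) has sum (1, a_{N−1} + a₀), so
-- S′ = {(1, a_{N−1} + a₀)} ∪ {0} × S. Starting from an even invariant factor (m₁ itself when
-- m₁ = 2) and lifting along all other factors gives the stated sizes; if m₁ > 2 then every
-- factor exceeds 2 because m₁ divides all of them.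

module Submission where

open import Defs
open import Data.Fin using (Fin; zero; suc; toℕ)
open import Data.Fin.Properties using (toℕ-injective; toℕ-fromℕ<; toℕ<n)
open import Data.List using (List; []; _∷_; _++_; [_]; map; length; applyUpTo; cartesianProductWith; zipWith)
open import Data.List.Membership.Propositional using (_∈_)
open import Data.List.Membership.Propositional.Properties using (∈-map⁺; ∈-applyUpTo⁺; ∈-cartesianProductWith⁺)
open import Data.List.Properties using (length-map; ++-identityʳ)
open import Data.List.Relation.Binary.Subset.Propositional using (_⊆_)
open import Data.List.Relation.Unary.All as All using (All; []; _∷_)
import Data.List.Relation.Unary.All.Properties as All
open import Data.List.Relation.Unary.AllPairs as AllPairs using (_∷_)
open import Data.List.Relation.Unary.Any using (here; there)
open import Data.List.Relation.Unary.Linked using (Linked)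
open import Data.List.Relation.Unary.Linked.Properties using (Linked⇒AllPairs)
open import Data.List.Relation.Unary.Unique.Propositional using (Unique)
import Data.List.Relation.Unary.Unique.Propositional.Properties as Unique
open import Data.Nat using (ℕ; zero; suc; _+_; _*_; _∸_; _<_; _≤_; z≤n; s≤s; _%_; _/_; parity; NonZero)
open import Data.Nat.DivMod using (_mod_; m%n<n; m<n⇒m%n≡m; n%n≡0; %-distribˡ-+; [m+n]%n≡m%n; m≡m%n+[m/n]*n)
open import Data.Nat.Divisibility using (_∣_; _∣?_; divides; ∣⇒≤; ∣1⇒≡1; ∣-trans)
open import Data.Nat.ListAction using (product)
open import Data.Nat.Primality using (euclidsLemma; prime[2])
open import Data.Nat.Properties
open import Data.Parity.Base using (Parity; 0ℙ; 1ℙ; _⁻¹)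
import Data.Parity.Base as ℙ
import Data.Parity.Properties as ℙ
open import Data.Product using (∃; _×_; _,_; proj₁; proj₂; zip′)
open import Data.Product.Algebra using (×-comm; ×-assoc)
open import Data.Sum using (inj₁; inj₂)
open import Data.Unit using (tt)
open import Function using (_∘_; _↔_; Inverse; mk↔ₛ′)
open import Function.Properties.Inverse using (↔-sym)
open import Level using (0ℓ)
open import Relation.Binary.PropositionalEquality using (_≡_; _≢_; refl; sym; trans; cong; cong₂; subst; module ≡-Reasoning)
open import Relation.Nullary using (yes; no; contradiction)

private
  variable
    A B : Set
    R R′ : A → A → Set
    x y z w : A
    xs zs : List A

parity-suc : ∀ i → parity (suc i) ≡ parity i ⁻¹
parity-suc i = sym (ℙ.⁻¹-selfInverse (ℙ.suc-homo-⁻¹ i))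

parity-∸ : ∀ {m k} → parity m ≡ 0ℙ → k ≤ m → parity (m ∸ k) ≡ parity k
parity-∸ {m} {k} m-even k≤m = ℙ.+-cancelʳ-≡ (parity k) _ _ (begin
  parity (m ∸ k) ℙ.+ parity k  ≡⟨ ℙ.+-homo-+ (m ∸ k) k ⟨
  parity (m ∸ k + k)           ≡⟨ cong parity (m∸n+n≡m k≤m) ⟩
  parity m                     ≡⟨ m-even ⟩
  0ℙ                           ≡⟨ ℙ.p+p≡0ℙ (parity k) ⟨
  parity k ℙ.+ parity k        ∎)
  where open ≡-Reasoning

parity-% : ∀ i m .{{_ : NonZero m}} → parity m ≡ 0ℙ → parity (i % m) ≡ parity i
parity-% i m m-even = sym (begin
  parity i                                ≡⟨ cong parity (m≡m%n+[m/n]*n i m) ⟩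
  parity (i % m + i / m * m)              ≡⟨ ℙ.+-homo-+ (i % m) (i / m * m) ⟩
  parity (i % m) ℙ.+ parity (i / m * m)   ≡⟨ cong (parity (i % m) ℙ.+_) multiple-even ⟩
  parity (i % m) ℙ.+ 0ℙ                   ≡⟨ ℙ.+-identityʳ (parity (i % m)) ⟩
  parity (i % m)                          ∎)
  where
    open ≡-Reasoning
    multiple-even : parity (i / m * m) ≡ 0ℙ
    multiple-even = trans (ℙ.*-homo-* (i / m) m)
                          (trans (cong (parity (i / m) ℙ.*_) m-even) (ℙ.*-zeroʳ (parity (i / m))))

2∣⇒parity≡0ℙ : ∀ {m} → 2 ∣ m → parity m ≡ 0ℙ
2∣⇒parity≡0ℙ (divides q refl) = trans (ℙ.*-homo-* q 2) (ℙ.*-zeroʳ (parity q))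

data Walk (R : A → A → Set) : A → List A → A → Set where
  []  : Walk R x [] x
  _∷_ : ∀ {ys} → R x y → Walk R y ys z → Walk R x (y ∷ ys) z

Walk-++⁺ : Walk R x xs y → R y z → Walk R z zs w → Walk R x (xs ++ z ∷ zs) w
Walk-++⁺ []      r v = r ∷ v
Walk-++⁺ (s ∷ u) r v = s ∷ Walk-++⁺ u r v

Walk-map⁺ : (f : A → B) → (∀ {x y} → R x y → R′ (f x) (f y)) →
            Walk R x xs y → Walk R′ (f x) (map f xs) (f y)
Walk-map⁺ f f-edge []      = []
Walk-map⁺ f f-edge (r ∷ u) = f-edge r ∷ Walk-map⁺ f f-edge u

Walk-mono : (∀ {x y} → R x y → R′ x y) → Walk R x xs y → Walk R′ x xs y
Walk-mono R⇒R′ []      = []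
Walk-mono R⇒R′ (r ∷ u) = R⇒R′ r ∷ Walk-mono R⇒R′ u

Walk-applyUpTo⁺ : (f : ℕ → A) (n : ℕ) → (∀ i → i < n → R (f i) (f (suc i))) →
                  Walk R (f 0) (applyUpTo (f ∘ suc) n) (f n)
Walk-applyUpTo⁺ f zero    step = []
Walk-applyUpTo⁺ f (suc n) step =
  step 0 (s≤s z≤n) ∷ Walk-applyUpTo⁺ (f ∘ suc) n (λ i i<n → step (suc i) (s≤s i<n))

Edge : (A → A → A) → List A → (A → Parity) → A → A → Set
Edge _∙_ S colour x y = x ∙ y ∈ S × colour y ≡ colour x ⁻¹

record ColouredHamiltonCycle {A : Set} (_∙_ : A → A → A) (S : List A) : Set where
  field
    colour       : A → Parity
    first        : A
    rest         : List A
    last         : A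
    unique       : Unique (first ∷ rest)
    complete     : ∀ a → a ∈ first ∷ rest
    first-colour : colour first ≡ 0ℙ
    walk         : Walk (Edge _∙_ S colour) first rest last
    closing      : Edge _∙_ S colour last first

ColouredHamiltonian : (A → A → A) → ℕ → Set
ColouredHamiltonian {A} _∙_ k =
  ∃ λ (S : List A) → Unique S × length S ≡ k × ColouredHamiltonCycle _∙_ S

ColouredHamiltonCycle-mono : ∀ {_∙_ : A → A → A} {S S′} → S ⊆ S′ →
                             ColouredHamiltonCycle _∙_ S → ColouredHamiltonCycle _∙_ S′
ColouredHamiltonCycle-mono {_∙_ = _∙_} {S} {S′} S⊆S′ c = record
  { ColouredHamiltonCycle c hiding (walk; closing)
  ; walk    = Walk-mono widen walk
  ; closing = widen closing
  }
  where
    open ColouredHamiltonCycle c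
    widen : ∀ {x y} → Edge _∙_ S colour x y → Edge _∙_ S′ colour x y
    widen (x∙y∈S , alternates) = S⊆S′ x∙y∈S , alternates

ColouredHamiltonCycle⇒Hamiltonian : ∀ {ms} {S : List (Grp ms)} →
                                    ColouredHamiltonCycle _⊕_ S → Hamiltonian S
ColouredHamiltonCycle⇒Hamiltonian {S = S} c = first ∷ rest , unique , complete , sums walk
  where
    open ColouredHamiltonCycle c
    sums : ∀ {x xs} → Walk (Edge _⊕_ S colour) x xs last →
           All (_∈ S) (zipWith _⊕_ (x ∷ xs) (xs ++ [ first ]))
    sums []      = proj₁ closing ∷ []
    sums (e ∷ u) = proj₁ e ∷ sums u

module _ {_∙_ : A → A → A} {_∙′_ : B → B → B} (e : A ↔ B)
         (homo : ∀ x y → Inverse.to e (x ∙ y) ≡ Inverse.to e x ∙′ Inverse.to e y) where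
  open Inverse e

  private
    to-injective : to x ≡ to y → x ≡ y
    to-injective {x} {y} eq =
      trans (sym (strictlyInverseʳ x)) (trans (cong from eq) (strictlyInverseʳ y))

  ColouredHamiltonCycle-↔ : ∀ {S} → ColouredHamiltonCycle _∙_ S →
                            ColouredHamiltonCycle _∙′_ (map to S)
  ColouredHamiltonCycle-↔ {S} c = record
    { colour       = colour ∘ from
    ; first        = to first
    ; rest         = map to rest
    ; last         = to last
    ; unique       = Unique.map⁺ to-injective unique
    ; complete     = λ b → subst (_∈ map to (first ∷ rest)) (strictlyInverseˡ b)
                                  (∈-map⁺ to (complete (from b)))
    ; first-colour = trans (cong colour (strictlyInverseʳ first)) first-colour
    ; walk         = Walk-map⁺ to edge walk
    ; closing      = edge closing
    }
    where
      open ColouredHamiltonCycle c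
      edge : ∀ {x y} → Edge _∙_ S colour x y → Edge _∙′_ (map to S) (colour ∘ from) (to x) (to y)
      edge {x} {y} (x∙y∈S , alternates) =
        subst (_∈ map to S) (homo x y) (∈-map⁺ to x∙y∈S) ,
        trans (cong colour (strictlyInverseʳ y))
              (trans alternates (cong (λ a → colour a ⁻¹) (sym (strictlyInverseʳ x))))

  ColouredHamiltonian-↔ : ∀ {k} → ColouredHamiltonian _∙_ k → ColouredHamiltonian _∙′_ k
  ColouredHamiltonian-↔ (S , S-unique , S-length , c) =
    map to S , Unique.map⁺ to-injective S-unique , trans (length-map to S) S-length ,
    ColouredHamiltonCycle-↔ c

module _ {_∙_ : A → A → A} {S : List A} where

  periodic-ColouredHamiltonCycle :
    (colour : A → Parity) (v : ℕ → A) (n : ℕ) →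
    Unique (applyUpTo v (suc n)) → (∀ a → a ∈ applyUpTo v (suc n)) →
    v (suc n) ≡ v 0 → (∀ i → colour (v i) ≡ parity i) →
    (∀ i → i ≤ n → v i ∙ v (suc i) ∈ S) →
    ColouredHamiltonCycle _∙_ S
  periodic-ColouredHamiltonCycle colour v n unique complete period colour-v step = record
    { colour       = colour
    ; first        = v 0
    ; rest         = applyUpTo (v ∘ suc) n
    ; last         = v n
    ; unique       = unique
    ; complete     = complete
    ; first-colour = colour-v 0
    ; walk         = Walk-applyUpTo⁺ v n (λ i i<n → edge i (<⇒≤ i<n))
    ; closing      = subst (Edge _∙_ S colour (v n)) period (edge n ≤-refl)
    }
    where
      edge : ∀ i → i ≤ n → Edge _∙_ S colour (v i) (v (suc i))
      edge i i≤n = step i i≤n ,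
                   trans (colour-v (suc i)) (trans (parity-suc i) (cong _⁻¹ (sym (colour-v i))))

module Modular (n : ℕ) where

  M : ℕ
  M = suc n

  toℕ-mod : ∀ i → toℕ (i mod M) ≡ i % M
  toℕ-mod i = toℕ-fromℕ< (m%n<n i M)

  toℕ-mod< : ∀ {i} → i < M → toℕ (i mod M) ≡ i
  toℕ-mod< {i} i<M = trans (toℕ-mod i) (m<n⇒m%n≡m i<M)

  mod-cong : ∀ {i j} → i % M ≡ j % M → i mod M ≡ j mod M
  mod-cong {i} {j} eq = toℕ-injective (trans (toℕ-mod i) (trans eq (sym (toℕ-mod j))))

  mod-injective : ∀ {i j} → i < M → j < M → i mod M ≡ j mod M → i ≡ j
  mod-injective i<M j<M eq = trans (sym (toℕ-mod< i<M)) (trans (cong toℕ eq) (toℕ-mod< j<M))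

  mod-toℕ : ∀ t → toℕ t mod M ≡ t
  mod-toℕ t = toℕ-injective (toℕ-mod< (toℕ<n t))

  M-mod : M mod M ≡ zero
  M-mod = mod-cong {M} {0} (n%n≡0 M)

  mod-+ : ∀ i j → (i mod M) +ₘ (j mod M) ≡ (i + j) mod M
  mod-+ i j = mod-cong {toℕ (i mod M) + toℕ (j mod M)} {i + j} (begin
    (toℕ (i mod M) + toℕ (j mod M)) % M  ≡⟨ cong₂ (λ a b → (a + b) % M) (toℕ-mod i) (toℕ-mod j) ⟩
    (i % M + j % M) % M                  ≡⟨ %-distribˡ-+ i j M ⟨
    (i + j) % M                          ∎)
    where open ≡-Reasoning

  +ₘ-comm : ∀ s t → s +ₘ t ≡ t +ₘ s
  +ₘ-comm s t = cong (_mod M) (+-comm (toℕ s) (toℕ t))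

  infix 30 -_
  -_ : Fin M → Fin M
  - t = (M ∸ toℕ t) mod M

  -‿mod : ∀ {k} → k ≤ M → - (k mod M) ≡ (M ∸ k) mod M
  -‿mod k≤M with m≤n⇒m<n∨m≡n k≤M
  ... | inj₁ k<M  = cong (λ j → (M ∸ j) mod M) (toℕ-mod< k<M)
  ... | inj₂ refl = trans (cong -_ M-mod) (trans M-mod (cong (_mod M) (sym (n∸n≡0 n))))

  -‿involutive : ∀ t → - - t ≡ t
  -‿involutive t = begin
    - ((M ∸ toℕ t) mod M)    ≡⟨ -‿mod (m∸n≤m M (toℕ t)) ⟩
    (M ∸ (M ∸ toℕ t)) mod M  ≡⟨ cong (_mod M) (m∸[m∸n]≡n (<⇒≤ (toℕ<n t))) ⟩
    toℕ t mod M              ≡⟨ mod-toℕ t ⟩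
    t                        ∎
    where open ≡-Reasoning

  +ₘ-inverseʳ : ∀ t → t +ₘ - t ≡ zero
  +ₘ-inverseʳ t = begin
    t +ₘ - t                              ≡⟨ cong (_+ₘ - t) (mod-toℕ t) ⟨
    (toℕ t mod M) +ₘ ((M ∸ toℕ t) mod M)  ≡⟨ mod-+ (toℕ t) (M ∸ toℕ t) ⟩
    (toℕ t + (M ∸ toℕ t)) mod M           ≡⟨ cong (_mod M) (m+[n∸m]≡n (<⇒≤ (toℕ<n t))) ⟩
    M mod M                               ≡⟨ M-mod ⟩
    zero                                  ∎
    where open ≡-Reasoning

  sign : Parity → Fin M → Fin M
  sign 0ℙ t = t
  sign 1ℙ t = - t

  sign-involutive : ∀ c t → sign c (sign c t) ≡ t
  sign-involutive 0ℙ t = refl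
  sign-involutive 1ℙ t = -‿involutive t

  sign-injective : ∀ c {s t} → sign c s ≡ sign c t → s ≡ t
  sign-injective c {s} {t} eq =
    trans (sym (sign-involutive c s)) (trans (cong (sign c) eq) (sign-involutive c t))

  sign-cancel : ∀ c t → sign c t +ₘ sign (c ⁻¹) t ≡ zero
  sign-cancel 0ℙ t = +ₘ-inverseʳ t
  sign-cancel 1ℙ t = trans (+ₘ-comm (- t) t) (+ₘ-inverseʳ t)

  sign-step : ∀ c {i} → i < M →
              sign c (i mod M) +ₘ sign (c ⁻¹) (suc i mod M) ≡ sign (c ⁻¹) (1 mod M)
  sign-step 0ℙ {i} i<M = begin
    (i mod M) +ₘ - (suc i mod M)      ≡⟨ cong ((i mod M) +ₘ_) (-‿mod i<M) ⟩
    (i mod M) +ₘ ((M ∸ suc i) mod M)  ≡⟨ mod-+ i (M ∸ suc i) ⟩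
    (i + (n ∸ i)) mod M               ≡⟨ cong (_mod M) (m+[n∸m]≡n (≤-pred i<M)) ⟩
    n mod M                           ≡⟨ -‿mod (s≤s z≤n) ⟨
    - (1 mod M)                       ∎
    where open ≡-Reasoning
  sign-step 1ℙ {i} i<M = begin
    - (i mod M) +ₘ (suc i mod M)      ≡⟨ cong (_+ₘ (suc i mod M)) (-‿mod (<⇒≤ i<M)) ⟩
    ((M ∸ i) mod M) +ₘ (suc i mod M)  ≡⟨ mod-+ (M ∸ i) (suc i) ⟩
    (M ∸ i + suc i) mod M             ≡⟨ cong (_mod M) (+-suc (M ∸ i) i) ⟩
    suc (M ∸ i + i) mod M             ≡⟨ cong (λ j → suc j mod M) (m∸n+n≡m (<⇒≤ i<M)) ⟩
    suc M mod M                       ≡⟨ mod-cong {suc M} {1} ([m+n]%n≡m%n 1 M) ⟩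
    1 mod M                           ∎
    where open ≡-Reasoning

module EvenCyclic (n : ℕ) (M-even : parity (suc n) ≡ 0ℙ) where
  open Modular n

  colour : Fin M → Parity
  colour t = parity (toℕ t)

  colour-mod : ∀ i → colour (i mod M) ≡ parity i
  colour-mod i = trans (cong parity (toℕ-mod i)) (parity-% i M M-even)

  colour-sign : ∀ c t → colour (sign c t) ≡ colour t
  colour-sign 0ℙ t = refl
  colour-sign 1ℙ t = trans (colour-mod (M ∸ toℕ t)) (parity-∸ M-even (<⇒≤ (toℕ<n t)))

  reflect : Fin M → Fin M
  reflect t = sign (colour t) t

  reflect-involutive : ∀ t → reflect (reflect t) ≡ t
  reflect-involutive t = trans (cong (λ c → sign c (reflect t)) (colour-sign (colour t) t))
                               (sign-involutive (colour t) t)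

  reflect-injective : ∀ {s t} → reflect s ≡ reflect t → s ≡ t
  reflect-injective {s} {t} eq =
    trans (sym (reflect-involutive s)) (trans (cong reflect eq) (reflect-involutive t))

  vertex : ℕ → Fin M
  vertex i = reflect (i mod M)

  connections : List (Fin M)
  connections = (1 mod M) ∷ - (1 mod M) ∷ []

  vertex-colour : ∀ i → colour (vertex i) ≡ parity i
  vertex-colour i = trans (colour-sign (colour (i mod M)) (i mod M)) (colour-mod i)

  vertex-step : ∀ {i} → i < M → vertex i +ₘ vertex (suc i) ∈ connections
  vertex-step {i} i<M = subst (_∈ connections) (sym sum) (sign-∈ (parity i ⁻¹))
    where
      open ≡-Reasoning
      sum : vertex i +ₘ vertex (suc i) ≡ sign (parity i ⁻¹) (1 mod M)
      sum = begin
        vertex i +ₘ vertex (suc i)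
          ≡⟨ cong₂ (λ c c′ → sign c (i mod M) +ₘ sign c′ (suc i mod M))
                   (colour-mod i) (trans (colour-mod (suc i)) (parity-suc i)) ⟩
        sign (parity i) (i mod M) +ₘ sign (parity i ⁻¹) (suc i mod M)
          ≡⟨ sign-step (parity i) i<M ⟩
        sign (parity i ⁻¹) (1 mod M) ∎
      sign-∈ : ∀ c → sign c (1 mod M) ∈ connections
      sign-∈ 0ℙ = here refl
      sign-∈ 1ℙ = there (here refl)

  cycle : ColouredHamiltonCycle _+ₘ_ connections
  cycle = periodic-ColouredHamiltonCycle colour vertex n
    (Unique.applyUpTo⁺₁ vertex M (λ i<j j<M →
      <⇒≢ i<j ∘ mod-injective (<-trans i<j j<M) j<M ∘ reflect-injective))
    (λ t → subst (_∈ applyUpTo vertex M)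
                 (trans (cong reflect (mod-toℕ (reflect t))) (reflect-involutive t))
                 (∈-applyUpTo⁺ vertex (toℕ<n (reflect t))))
    (cong reflect M-mod)
    vertex-colour
    (λ i i≤n → vertex-step (s≤s i≤n))

cyclic₂-ColouredHamiltonian : ColouredHamiltonian (_+ₘ_ {2}) 1
cyclic₂-ColouredHamiltonian =
  suc zero ∷ [] , (All.[] AllPairs.∷ AllPairs.[]) , refl ,
  -- in ℤ/2 the connection set {1, −1} collapses to {1}
  ColouredHamiltonCycle-mono (λ { (here eq) → here eq ; (there (here eq)) → here eq })
                             (EvenCyclic.cycle 1 refl)

cyclic-ColouredHamiltonian : ∀ {m} → 2 ∣ m → 2 < m → ColouredHamiltonian (_+ₘ_ {m}) 2
cyclic-ColouredHamiltonian {suc n} 2∣m (s≤s (s≤s 2≤n)) =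
  connections , ((1≢-1 ∷ []) AllPairs.∷ ([] AllPairs.∷ AllPairs.[])) , refl , cycle
  where
    open Modular n
    open EvenCyclic n (2∣⇒parity≡0ℙ 2∣m)
    1≢-1 : 1 mod M ≢ - (1 mod M)
    1≢-1 eq = <⇒≢ (s≤s 2≤n)
                  (mod-injective {1} {n} (s≤s (s≤s z≤n)) ≤-refl (trans eq (-‿mod (s≤s z≤n))))

module Lift {_∙_ : A → A → A} {S : List A} (n : ℕ) (c : ColouredHamiltonCycle _∙_ S) where
  open Modular (suc n)
  open ColouredHamiltonCycle c

  vertex : Fin M → A → Fin M × A
  vertex t a = sign (colour a) t , a

  connections : List (Fin M × A)
  connections = (1 mod M , last ∙ first) ∷ map (zero ,_) S

  Edge′ : Fin M × A → Fin M × A → Set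
  Edge′ = Edge (zip′ _+ₘ_ _∙_) connections (colour ∘ proj₂)

  LapStep : Fin M → Fin M → Set
  LapStep t t′ = - t +ₘ t′ ≡ 1 mod M

  last-colour : colour last ≡ 1ℙ
  last-colour = sym (ℙ.⁻¹-selfInverse (trans (sym (proj₂ closing)) first-colour))

  within-lap : ∀ t {x y} → Edge _∙_ S colour x y → Edge′ (vertex t x) (vertex t y)
  within-lap t {x} {y} (x∙y∈S , alternates) =
    subst (λ s → (s , x ∙ y) ∈ connections) (sym cancel) (there (∈-map⁺ (zero ,_) x∙y∈S)) ,
    alternates
    where
      cancel : sign (colour x) t +ₘ sign (colour y) t ≡ zero
      cancel = trans (cong (λ c → sign (colour x) t +ₘ sign c t) alternates)
                     (sign-cancel (colour x) t)

  between-laps : ∀ {t t′} → LapStep t t′ → Edge′ (vertex t last) (vertex t′ first)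
  between-laps {t} {t′} step =
    subst (λ s → (s , last ∙ first) ∈ connections) (sym sum) (here refl) , proj₂ closing
    where
      sum : sign (colour last) t +ₘ sign (colour first) t′ ≡ 1 mod M
      sum = trans (cong₂ (λ c c′ → sign c t +ₘ sign c′ t′) last-colour first-colour) step

  laps-after : Fin M → List (Fin M) → List (Fin M × A)
  laps-after t ts = map (vertex t) rest ++ cartesianProductWith vertex ts (first ∷ rest)

  laps-walk : ∀ {t ts t′} → Walk LapStep t ts t′ →
              Walk Edge′ (vertex t first) (laps-after t ts) (vertex t′ last)
  laps-walk {t} [] = subst (λ vs → Walk Edge′ (vertex t first) vs (vertex t last))
                           (sym (++-identityʳ _)) (Walk-map⁺ (vertex t) (within-lap t) walk)
  laps-walk {t} (step ∷ u) =
    Walk-++⁺ (Walk-map⁺ (vertex t) (within-lap t) walk) (between-laps step) (laps-walk u)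

  vertex-injective : ∀ {t t′ a a′} → vertex t a ≡ vertex t′ a′ → t ≡ t′ × a ≡ a′
  vertex-injective {a = a} eq with cong proj₂ eq
  ... | refl = sign-injective (colour a) (cong proj₁ eq) , refl

  cycle : ColouredHamiltonCycle (zip′ _+ₘ_ _∙_) connections
  cycle = record
    { colour       = colour ∘ proj₂
    ; first        = vertex zero first
    ; rest         = laps-after zero (applyUpTo (λ i → suc i mod M) (suc n))
    ; last         = vertex (suc n mod M) last
    ; unique       = Unique.cartesianProductWith⁺ vertex vertex-injective lap-indices-unique unique
    ; complete     = λ (t , a) → subst (_∈ _) (cong (_, a) (sign-involutive (colour a) t))
                       (∈-cartesianProductWith⁺ vertex (∈-lap-indices (sign (colour a) t)) (complete a))
    ; first-colour = first-colour
    ; walk         = laps-walk (Walk-applyUpTo⁺ (_mod M) (suc n) (λ i → sign-step 1ℙ ∘ m<n⇒m<1+n))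
    ; closing      = between-laps (subst (LapStep (suc n mod M)) M-mod (sign-step 1ℙ (n<1+n (suc n))))
    }
    where
      lap-indices : List (Fin M)
      lap-indices = applyUpTo (_mod M) M

      lap-indices-unique : Unique lap-indices
      lap-indices-unique = Unique.applyUpTo⁺₁ (_mod M) M
        (λ i<j j<M → <⇒≢ i<j ∘ mod-injective (<-trans i<j j<M) j<M)

      ∈-lap-indices : ∀ t → t ∈ lap-indices
      ∈-lap-indices t = subst (_∈ lap-indices) (mod-toℕ t) (∈-applyUpTo⁺ (_mod M) (toℕ<n t))

cyclic×-ColouredHamiltonian : ∀ {_∙_ : A → A → A} {m k} → 1 < m → ColouredHamiltonian _∙_ k →
                              ColouredHamiltonian (zip′ (_+ₘ_ {m}) _∙_) (suc k)
cyclic×-ColouredHamiltonian {m = suc (suc n)} (s≤s (s≤s z≤n)) (S , S-unique , S-length , c) =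
  connections ,
  (All.map⁺ (All.universal (λ _ ()) S) AllPairs.∷ Unique.map⁺ (cong proj₂) S-unique) ,
  cong suc (trans (length-map (zero ,_) S) S-length) ,
  cycle
  where open Lift n c

Grp×-ColouredHamiltonian : ∀ {_∙_ : A → A → A} {k} ms → All (1 <_) ms → ColouredHamiltonian _∙_ k →
                           ColouredHamiltonian (zip′ (_⊕_ {ms}) _∙_) (length ms + k)
Grp×-ColouredHamiltonian [] [] =
  ColouredHamiltonian-↔ (mk↔ₛ′ (tt ,_) proj₂ (λ _ → refl) (λ _ → refl)) (λ _ _ → refl)
Grp×-ColouredHamiltonian (m ∷ ms) (1<m ∷ 1<ms) =
  ColouredHamiltonian-↔ (↔-sym (×-assoc 0ℓ _ _ _)) (λ _ _ → refl)
  ∘ cyclic×-ColouredHamiltonian 1<m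
  ∘ Grp×-ColouredHamiltonian ms 1<ms

cyclic⊕Grp-ColouredHamiltonian : ∀ {m k} ms → All (1 <_) ms → ColouredHamiltonian (_+ₘ_ {m}) k →
                                 ColouredHamiltonian (_⊕_ {m ∷ ms}) (length ms + k)
cyclic⊕Grp-ColouredHamiltonian ms 1<ms =
  ColouredHamiltonian-↔ (×-comm _ _) (λ _ _ → refl) ∘ Grp×-ColouredHamiltonian ms 1<ms

Grp-ColouredHamiltonian : ∀ ms → All (2 <_) ms → 2 ∣ product ms →
                          ColouredHamiltonian (_⊕_ {ms}) (suc (length ms))
Grp-ColouredHamiltonian [] [] 2∣1 = contradiction (∣1⇒≡1 2∣1) λ ()
Grp-ColouredHamiltonian (m ∷ ms) (2<m ∷ 2<ms) 2∣∏
  with 2 ∣? m | euclidsLemma m (product ms) prime[2] 2∣∏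
... | yes 2∣m | _ =
  subst (ColouredHamiltonian _⊕_) (+-comm (length ms) 2)
        (cyclic⊕Grp-ColouredHamiltonian ms (All.map (<-trans (n<1+n 1)) 2<ms)
                                       (cyclic-ColouredHamiltonian 2∣m 2<m))
... | no 2∤m | inj₁ 2∣m    = contradiction 2∣m 2∤m
... | no _   | inj₂ 2∣∏ms =
  cyclic×-ColouredHamiltonian (<-trans (n<1+n 1) 2<m) (Grp-ColouredHamiltonian ms 2<ms 2∣∏ms)

∣-chain-above : ∀ {b m₁ ms} → b < m₁ → Linked _∣_ (m₁ ∷ ms) → All (1 <_) ms → All (b <_) (m₁ ∷ ms)
∣-chain-above {b} {m₁} b<m₁ chain 1<ms with Linked⇒AllPairs ∣-trans chain
... | m₁∣ms AllPairs.∷ _ = b<m₁ ∷ All.zipWith above (m₁∣ms , 1<ms)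
  where
    above : ∀ {m} → m₁ ∣ m × 1 < m → b < m
    above (m₁∣m , s≤s (s≤s z≤n)) = <-≤-trans b<m₁ (∣⇒≤ m₁∣m)

lemma1 : (m₁ : ℕ) (ms : List ℕ) →
    All (1 <_) (m₁ ∷ ms) → Linked _∣_ (m₁ ∷ ms) → 2 ∣ product (m₁ ∷ ms) →
    ∃ λ (S : List (Grp (m₁ ∷ ms))) →
      Unique S
      × (m₁ ≡ 2 → length S ≡ length (m₁ ∷ ms))
      × (2 < m₁ → length S ≡ suc (length (m₁ ∷ ms)))
      × Hamiltonian S
lemma1 m₁ ms (1<m₁ ∷ 1<ms) chain 2∣∏ with m₁ ≟ 2
... | yes refl =
  let S , S-unique , S-length , c = cyclic⊕Grp-ColouredHamiltonian ms 1<ms cyclic₂-ColouredHamiltonian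
  in  S , S-unique , (λ _ → trans S-length (+-comm (length ms) 1)) ,
      (λ 2<2 → contradiction 2<2 (<-irrefl refl)) , ColouredHamiltonCycle⇒Hamiltonian c
... | no m₁≢2 =
  let 2<m₁ = ≤∧≢⇒< 1<m₁ (m₁≢2 ∘ sym)
      S , S-unique , S-length , c = Grp-ColouredHamiltonian (m₁ ∷ ms) (∣-chain-above 2<m₁ chain 1<ms) 2∣∏
  in  S , S-unique , (λ m₁≡2 → contradiction m₁≡2 m₁≢2) , (λ _ → S-length) ,
      ColouredHamiltonCycle⇒Hamiltonian c
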